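{- Let $\mathcal{A},\mathcal{B},\mathcal{C},\mathcal{D}$ be arbitrary permutation classes and let $\mathcal{E}=\operatorname{Grid}\begin{pmatrix}\mathcal{A}&\mathcal{B}\\ \mathcal{C}&\mathcal{D}\end{pmatrix}$. Let $S_{\le}$ be the set of permutations $\pi$ admitting a division triple $(v,r,\ell)$ (with respect to $\mathcal{A},\mathcal{B},\mathcal{C},\mathcal{D}$) in which $\ell$ is no higher than $r$, and let $S_{\ge}$ be the set of permutations admitting a division triple in which $\ell$ is no lower than $r$. Then $\mathcal{E}=S_{\le}\cap S_{\ge}$.
   Context: Permutations are identified with their plots $\{(i,\pi(i))\}$ in the plane; a permutation class is a set of permutations closed downward under pattern containment (the empty permutation lies in every class). The grid class $\operatorname{Grid}\begin{pmatrix}\mathcal{A}&\mathcal{B}\\ \mathcal{C}&\mathcal{D}\end{pmatrix}$ is the set of permutations $\pi$ for which there exist a vertical and a horizontal line dividing the plot of $\pi$ into four rectangles whose points (top-left, top-right, bottom-left, bottom-right) form permutations in $\mathcal{A},\mathcal{B},\mathcal{C},\mathcal{D}$ respectively. A division triple for $\pi$ is a triple $(v,r,\ell)$ where $v$ is a vertical line splitting the points of $\pi$ into a left part and a right part, $\ell$ is a horizontal line such that the points of the left part above $\ell$ form a permutation in $\mathcal{A}$ and those below $\ell$ form a permutation in $\mathcal{C}$, and $r$ is a horizontal line such that the points of the right part above $r$ form a permutation in $\mathcal{B}$ and those below $r$ form a permutation in $\mathcal{D}$. (Heights of lines are compared via the set of points of $\pi$ lying below them; a permutation has a division triple iff it lies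 in the horizontal juxtaposition of the vertical juxtapositions of $\mathcal{A}$ over $\mathcal{C}$ and of $\mathcal{B}$ over $\mathcal{D}$.) -}

module Defs where

open import Level using (0ℓ; suc)
open import Data.Nat using (ℕ; zero; suc; _≤_; _<_; _≤?_; _<?_)
open import Data.List using (List; []; _∷_; length; take; drop; filter; upTo)
open import Data.List.Relation.Binary.Permutation.Propositional using (_↭_)
open import Data.List.Relation.Binary.Sublist.Propositional using (_⊆_)
open import Data.Product using (Σ; ∃; ∃-syntax; _×_; _,_)
open import Function.Bundles using (_⇔_)

-- Permutations are written in one-line notation as lists of naturals:
-- π = [π(0), …, π(n-1)], a rearrangement of 0, …, n-1.
-- Its plot is the point set {(i, π(i))}.

-- i-th entry (default 0 outside the range; only used in range)
at : List ℕ → ℕ → ℕ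
at []       _       = 0
at (x ∷ xs) zero    = x
at (x ∷ xs) (suc i) = at xs i

IsPerm : List ℕ → Set
IsPerm xs = xs ↭ upTo (length xs)

OrdIso : List ℕ → List ℕ → Set
OrdIso xs ys =
  length xs ≡ length ys ×
  (∀ i j → i < length xs → j < length xs → (at xs i < at xs j) ⇔ (at ys i < at ys j))
  where open import Relation.Binary.PropositionalEquality using (_≡_)

_≼_ : List ℕ → List ℕ → Set
σ ≼ π = ∃[ ys ] (ys ⊆ π × OrdIso σ ys)

record PermClass : Set₁ where
  field
    Mem       : List ℕ → Set
    mem-perm  : ∀ {π} → Mem π → IsPerm π
    mem-empty : Mem []
    down      : ∀ {σ π} → IsPerm σ → σ ≼ π → Mem π → Mem σ
open PermClass public

-- A sequence of distinct values (a set of points of a plot, read left to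
-- right) "forms a permutation in 𝒞": its pattern belongs to 𝒞.
FormsIn : PermClass → List ℕ → Set
FormsIn 𝒞 ys = ∃[ σ ] (Mem 𝒞 σ × OrdIso σ ys)

-- Lines: the vertical line at position k separates take k π | drop k π;
-- the horizontal line at height h has below it the points with value < h.
-- For π a permutation of length n, lines are indexed by 0 ≤ k, h ≤ n,
-- and "height" comparison of horizontal lines is comparison of h.
above : ℕ → List ℕ → List ℕ
above h = filter (λ x → h ≤? x)

below : ℕ → List ℕ → List ℕ
below h = filter (λ x → x <? h)

DivisionTriple : (𝒜 ℬ 𝒞 𝒟 : PermClass) → List ℕ → ℕ → ℕ → ℕ → Set
DivisionTriple 𝒜 ℬ 𝒞 𝒟 π k r l =
  k ≤ length π × r ≤ length π × l ≤ length π ×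
  FormsIn 𝒜 (above l (take k π)) × FormsIn 𝒞 (below l (take k π)) ×
  FormsIn ℬ (above r (drop k π)) × FormsIn 𝒟 (below r (drop k π))

Grid : (𝒜 ℬ 𝒞 𝒟 : PermClass) → List ℕ → Set
Grid 𝒜 ℬ 𝒞 𝒟 π =
  IsPerm π ×
  ∃[ k ] ∃[ h ] (k ≤ length π × h ≤ length π ×
    FormsIn 𝒜 (above h (take k π)) × FormsIn ℬ (above h (drop k π)) ×
    FormsIn 𝒞 (below h (take k π)) × FormsIn 𝒟 (below h (drop k π)))

S≤ : (𝒜 ℬ 𝒞 𝒟 : PermClass) → List ℕ → Set
S≤ 𝒜 ℬ 𝒞 𝒟 π = IsPerm π × ∃[ k ] ∃[ r ] ∃[ l ] (DivisionTriple 𝒜 ℬ 𝒞 𝒟 π k r l × l ≤ r)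

S≥ : (𝒜 ℬ 𝒞 𝒟 : PermClass) → List ℕ → Set
S≥ 𝒜 ℬ 𝒞 𝒟 π = IsPerm π × ∃[ k ] ∃[ r ] ∃[ l ] (DivisionTriple 𝒜 ℬ 𝒞 𝒟 π k r l × r ≤ l)

module Submission where

-- A grid witness (k , h) is a division triple (k , h , h), so Grid ⊆ S≤ ∩ S≥.
-- Conversely, take triples (k , r , l) with l ≤ r and (k' , r' , l') with
-- r' ≤ l'.  Comparing k with k' and then the appropriate pair of horizontal
-- lines, one of the four lines r, l, r', l' together with k or k' is a single
-- horizontal cut whose four quadrants are each contained in a quadrant of one
-- of the two triples.  Hence it suffices that "forms a permutation in 𝒞" is
-- inherited by subsequences (of a sequence of distinct values).

open import Defs
open import Data.Nat using (ℕ; zero; suc; _≤_; _<_; _<?_; z≤n; s≤s)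
open import Data.Nat.Properties
open import Data.List using (List; []; _∷_; length; take; drop; upTo; map; _++_; [_])
open import Data.List.Properties using (upTo-∷ʳ; map-++; length-map; map-id-local; map-cong-local; map-∘)
open import Data.List.Membership.Propositional using (_∈_; _∉_)
import Data.List.Relation.Unary.All as All
open import Data.List.Relation.Unary.All.Properties using (all-upTo)
open import Data.List.Relation.Unary.Any using (here; there)
open import Data.List.Relation.Unary.AllPairs using (_∷_)
open import Data.List.Relation.Unary.Unique.Propositional using (Unique)
import Data.List.Relation.Unary.Unique.Propositional.Properties as Unique
open import Data.List.Relation.Binary.Permutation.Propositional
  using (_↭_; ↭-sym; ↭-refl; ↭-prep; ↭⇒↭ₛ; module PermutationReasoning)
open import Data.List.Relation.Binary.Permutation.Propositional.Properties using (++⁺ʳ; ++-comm; map⁺)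
open import Data.List.Relation.Binary.Permutation.Setoid.Properties using (Unique-resp-↭)
open import Data.List.Relation.Binary.Sublist.Propositional using (_⊆_; []; _∷_; _∷ʳ_; ⊆-refl)
open import Data.List.Relation.Binary.Sublist.Propositional.Properties using (filter⁺; take⁺; drop⁺-≥)
open import Data.Product using (∃-syntax; _×_; _,_)
open import Data.Sum using (inj₁; inj₂)
open import Data.Empty using (⊥-elim)
open import Function.Bundles using (_⇔_; mk⇔; Equivalence)
open import Relation.Binary.PropositionalEquality
  using (_≡_; _≢_; refl; sym; trans; cong; cong₂; subst; subst₂; setoid; module ≡-Reasoning)
open import Relation.Nullary using (yes; no)

rank : List ℕ → ℕ → ℕ
rank []       x = 0
rank (z ∷ zs) x with z <? x
... | yes _ = suc (rank zs x)
... | no  _ = rank zs x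

rank-mono : ∀ zs {x y} → x ≤ y → rank zs x ≤ rank zs y
rank-mono []       x≤y = z≤n
rank-mono (z ∷ zs) {x} {y} x≤y with z <? x | z <? y
... | yes _   | yes _   = s≤s (rank-mono zs x≤y)
... | yes z<x | no  z≮y = ⊥-elim (z≮y (<-≤-trans z<x x≤y))
... | no  _   | yes _   = m≤n⇒m≤1+n (rank-mono zs x≤y)
... | no  _   | no  _   = rank-mono zs x≤y

-- The rank is strictly monotone on the entries of zs: x itself is counted
-- by rank zs y but not by rank zs x.
rank-strict : ∀ zs {x y} → x < y → x ∈ zs → rank zs x < rank zs y
rank-strict (z ∷ zs) {x} {y} x<y (here refl) with z <? x | z <? y
... | yes x<x | _       = ⊥-elim (<-irrefl refl x<x)
... | no  _   | yes _   = s≤s (rank-mono zs (<⇒≤ x<y))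
... | no  _   | no  x≮y = ⊥-elim (x≮y x<y)
rank-strict (z ∷ zs) {x} {y} x<y (there x∈zs) with z <? x | z <? y
... | yes _   | yes _   = s≤s (rank-strict zs x<y x∈zs)
... | yes z<x | no  z≮y = ⊥-elim (z≮y (<-trans z<x x<y))
... | no  _   | yes _   = m≤n⇒m≤1+n (rank-strict zs x<y x∈zs)
... | no  _   | no  _   = rank-strict zs x<y x∈zs

rank-≤-length : ∀ zs x → rank zs x ≤ length zs
rank-≤-length []       x = z≤n
rank-≤-length (z ∷ zs) x with z <? x
... | yes _ = s≤s (rank-≤-length zs x)
... | no  _ = m≤n⇒m≤1+n (rank-≤-length zs x)

rank-reflects-< : ∀ zs {x y} → rank zs x < rank zs y → x < y
rank-reflects-< zs {x} {y} rx<ry with x <? y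
... | yes x<y = x<y
... | no  x≮y = ⊥-elim (<-irrefl refl (<-≤-trans rx<ry (rank-mono zs (≮⇒≥ x≮y))))

std : List ℕ → List ℕ
std zs = map (rank zs) zs

at-map : ∀ f zs i → i < length zs → at (map f zs) i ≡ f (at zs i)
at-map f (z ∷ zs) zero    _         = refl
at-map f (z ∷ zs) (suc i) (s≤s i<n) = at-map f zs i i<n

at-∈ : ∀ zs i → i < length zs → at zs i ∈ zs
at-∈ (z ∷ zs) zero    _         = here refl
at-∈ (z ∷ zs) (suc i) (s≤s i<n) = there (at-∈ zs i i<n)

std-ordIso : ∀ zs → OrdIso (std zs) zs
std-ordIso zs = length-map (rank zs) zs , compare
  where
  compare : ∀ i j → i < length (std zs) → j < length (std zs) →
            (at (std zs) i < at (std zs) j) ⇔ (at zs i < at zs j)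
  compare i j i<n j<n =
    let i< = subst (i <_) (length-map (rank zs) zs) i<n
        j< = subst (j <_) (length-map (rank zs) zs) j<n
        ei = at-map (rank zs) zs i i<
        ej = at-map (rank zs) zs j j<
    in mk⇔ (λ p → rank-reflects-< zs (subst₂ _<_ ei ej p))
           (λ p → subst₂ _<_ (sym ei) (sym ej) (rank-strict zs p (at-∈ zs i i<)))

bump : ℕ → ℕ → ℕ
bump c y with y <? c
... | yes _ = y
... | no  _ = suc y

bump-< : ∀ {c y} → y < c → bump c y ≡ y
bump-< {c} {y} y<c with y <? c
... | yes _   = refl
... | no  y≮c = ⊥-elim (y≮c y<c)

bump-≥ : ∀ {c y} → c ≤ y → bump c y ≡ suc y
bump-≥ {c} {y} c≤y with y <? c
... | yes y<c = ⊥-elim (<-irrefl refl (<-≤-trans y<c c≤y))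
... | no  _   = refl

bump-upTo : ∀ c m → c ≤ m → c ∷ map (bump c) (upTo m) ↭ upTo (suc m)
bump-upTo c m c≤m with m≤n⇒m<n∨m≡n c≤m
... | inj₂ refl = begin
  c ∷ map (bump c) (upTo c) ≡⟨ cong (c ∷_) (map-id-local (All.map bump-< (all-upTo c))) ⟩
  c ∷ upTo c                ↭⟨ ++-comm [ c ] (upTo c) ⟩
  upTo c ++ [ c ]           ≡⟨ upTo-∷ʳ c ⟩
  upTo (suc c)              ∎
  where open PermutationReasoning
bump-upTo c (suc m) _ | inj₁ c<1+m = begin
  c ∷ map (bump c) (upTo (suc m))          ≡⟨ cong (λ xs → c ∷ map (bump c) xs) (sym (upTo-∷ʳ m)) ⟩
  c ∷ map (bump c) (upTo m ++ [ m ])       ≡⟨ cong (c ∷_) (map-++ (bump c) (upTo m) [ m ]) ⟩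
  c ∷ map (bump c) (upTo m) ++ [ bump c m ] ≡⟨ cong (λ b → c ∷ map (bump c) (upTo m) ++ [ b ]) (bump-≥ c≤m) ⟩
  c ∷ map (bump c) (upTo m) ++ [ suc m ]   ↭⟨ ++⁺ʳ [ suc m ] (bump-upTo c m c≤m) ⟩
  upTo (suc m) ++ [ suc m ]                ≡⟨ upTo-∷ʳ (suc m) ⟩
  upTo (suc (suc m))                       ∎
  where
  open PermutationReasoning
  c≤m : c ≤ m
  c≤m = ≤-pred c<1+m

rank-∷-self : ∀ x zs → rank (x ∷ zs) x ≡ rank zs x
rank-∷-self x zs with x <? x
... | yes x<x = ⊥-elim (<-irrefl refl x<x)
... | no  _   = refl

rank-∷ : ∀ x zs {y} → y ∈ zs → y ≢ x → rank (x ∷ zs) y ≡ bump (rank zs x) (rank zs y)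
rank-∷ x zs {y} y∈zs y≢x with x <? y
... | yes x<y = sym (bump-≥ (rank-mono zs (<⇒≤ x<y)))
... | no  x≮y = sym (bump-< (rank-strict zs (≤∧≢⇒< (≮⇒≥ x≮y) y≢x) y∈zs))

std-∷ : ∀ x zs → x ∉ zs → std (x ∷ zs) ≡ rank zs x ∷ map (bump (rank zs x)) (std zs)
std-∷ x zs x∉zs = cong₂ _∷_ (rank-∷-self x zs) (begin
  map (rank (x ∷ zs)) zs                   ≡⟨ map-cong-local (All.tabulate shifted) ⟩
  map (λ y → bump c (rank zs y)) zs        ≡⟨ map-∘ zs ⟩
  map (bump c) (std zs)                    ∎)
  where
  open ≡-Reasoning
  c : ℕ
  c = rank zs x
  shifted : ∀ {y} → y ∈ zs → rank (x ∷ zs) y ≡ bump c (rank zs y)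
  shifted y∈zs = rank-∷ x zs y∈zs (λ { refl → x∉zs y∈zs })

std-isPerm : ∀ zs → Unique zs → IsPerm (std zs)
std-isPerm zs u = subst (λ n → std zs ↭ upTo n) (sym (length-map (rank zs) zs)) (std-↭ zs u)
  where
  std-↭ : ∀ zs → Unique zs → std zs ↭ upTo (length zs)
  std-↭ []       _                 = ↭-refl
  std-↭ (x ∷ zs) u@(_ ∷ zs-unique) = begin
    std (x ∷ zs)                           ≡⟨ std-∷ x zs (Unique.Unique[x∷xs]⇒x∉xs u) ⟩
    c ∷ map (bump c) (std zs)              ↭⟨ ↭-prep c (map⁺ (bump c) (std-↭ zs zs-unique)) ⟩
    c ∷ map (bump c) (upTo (length zs))    ↭⟨ bump-upTo c (length zs) (rank-≤-length zs x) ⟩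
    upTo (suc (length zs))                 ∎
    where
    open PermutationReasoning
    c : ℕ
    c = rank zs x

ordIso-trans : ∀ {xs ys zs} → OrdIso xs ys → OrdIso ys zs → OrdIso xs zs
ordIso-trans (xs≡ys , cmp₁) (ys≡zs , cmp₂) = trans xs≡ys ys≡zs , λ i j i< j< →
  let c₁ = cmp₁ i j i< j<
      c₂ = cmp₂ i j (subst (i <_) xs≡ys i<) (subst (j <_) xs≡ys j<)
  in mk⇔ (λ p → Equivalence.to c₂ (Equivalence.to c₁ p))
         (λ p → Equivalence.from c₁ (Equivalence.from c₂ p))

record Restriction (zs ys σ : List ℕ) : Set where
  field
    sub        : List ℕ
    sub⊆σ      : sub ⊆ σ
    length-sub : length sub ≡ length zs
    pos        : ℕ → ℕ
    pos-spec   : ∀ i → i < length zs →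
                 pos i < length ys × at zs i ≡ at ys (pos i) × at sub i ≡ at σ (pos i)

restrict : ∀ {zs ys} → zs ⊆ ys → ∀ σ → length σ ≡ length ys → Restriction zs ys σ
restrict []         []      _ = record
  { sub = [] ; sub⊆σ = [] ; length-sub = refl ; pos = λ i → i ; pos-spec = λ _ () }
restrict (y ∷ʳ zs⊆ys) (s ∷ σ) e = record
  { sub = sub ; sub⊆σ = s ∷ʳ sub⊆σ ; length-sub = length-sub ; pos = λ i → suc (pos i)
  ; pos-spec = λ i i< → let (p< , zi , si) = pos-spec i i< in s≤s p< , zi , si }
  where open Restriction (restrict zs⊆ys σ (suc-injective e))
restrict (refl ∷ zs⊆ys) (s ∷ σ) e = record
  { sub = s ∷ sub ; sub⊆σ = refl ∷ sub⊆σ ; length-sub = cong suc length-sub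
  ; pos = λ { zero → zero ; (suc i) → suc (pos i) }
  ; pos-spec = λ { zero    _         → s≤s z≤n , refl , refl
                 ; (suc i) (s≤s i<) → let (p< , zi , si) = pos-spec i i< in s≤s p< , zi , si } }
  where open Restriction (restrict zs⊆ys σ (suc-injective e))

ordIso-restrict : ∀ {σ ys zs} → OrdIso σ ys → zs ⊆ ys → ∃[ ws ] (ws ⊆ σ × OrdIso zs ws)
ordIso-restrict {σ} {ys} {zs} (σ≡ys , cmp) zs⊆ys = sub , sub⊆σ , sym length-sub , compare
  where
  open Restriction (restrict zs⊆ys σ σ≡ys)
  compare : ∀ i j → i < length zs → j < length zs → (at zs i < at zs j) ⇔ (at sub i < at sub j)
  compare i j i< j< =
    let (pi< , zi , si) = pos-spec i i<
        (pj< , zj , sj) = pos-spec j j<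
        c = cmp (pos i) (pos j) (subst (pos i <_) (sym σ≡ys) pi<) (subst (pos j <_) (sym σ≡ys) pj<)
    in mk⇔ (λ p → subst₂ _<_ (sym si) (sym sj) (Equivalence.from c (subst₂ _<_ zi zj p)))
           (λ p → subst₂ _<_ (sym zi) (sym zj) (Equivalence.to c (subst₂ _<_ si sj p)))

-- The pattern of zs is std zs, which is contained in the pattern σ ∈ 𝒞 of ys.
FormsIn-⊆ : ∀ 𝒞 {ys zs} → FormsIn 𝒞 ys → zs ⊆ ys → Unique zs → FormsIn 𝒞 zs
FormsIn-⊆ 𝒞 {zs = zs} (σ , σ∈𝒞 , σ≅ys) zs⊆ys zs-unique =
  std zs , down 𝒞 (std-isPerm zs zs-unique) std-zs≼σ σ∈𝒞 , std-ordIso zs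
  where
  std-zs≼σ : std zs ≼ σ
  std-zs≼σ with ws , ws⊆σ , zs≅ws ← ordIso-restrict σ≅ys zs⊆ys =
    ws , ws⊆σ , ordIso-trans {std zs} {zs} {ws} (std-ordIso zs) zs≅ws

module Quadrants {π : List ℕ} (π-perm : IsPerm π) where

  π-unique : Unique π
  π-unique = Unique-resp-↭ (setoid ℕ) (↭⇒↭ₛ (↭-sym π-perm)) (Unique.upTo⁺ (length π))

  above-take-unique : ∀ h k → Unique (above h (take k π))
  above-take-unique h k = Unique.filter⁺ _ (Unique.take⁺ k π-unique)

  above-drop-unique : ∀ h k → Unique (above h (drop k π))
  above-drop-unique h k = Unique.filter⁺ _ (Unique.drop⁺ k π-unique)

  below-take-unique : ∀ h k → Unique (below h (take k π))
  below-take-unique h k = Unique.filter⁺ _ (Unique.take⁺ k π-unique)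

  below-drop-unique : ∀ h k → Unique (below h (drop k π))
  below-drop-unique h k = Unique.filter⁺ _ (Unique.drop⁺ k π-unique)

  above-take-⊆ : ∀ {h h' k k'} → h' ≤ h → k ≤ k' → above h (take k π) ⊆ above h' (take k' π)
  above-take-⊆ h'≤h k≤k' = filter⁺ _ _ (λ { refl h≤x → ≤-trans h'≤h h≤x }) (take⁺ k≤k')

  above-drop-⊆ : ∀ {h h' k k'} → h' ≤ h → k' ≤ k → above h (drop k π) ⊆ above h' (drop k' π)
  above-drop-⊆ h'≤h k'≤k = filter⁺ _ _ (λ { refl h≤x → ≤-trans h'≤h h≤x }) (drop⁺-≥ k'≤k)

  below-take-⊆ : ∀ {h h' k k'} → h ≤ h' → k ≤ k' → below h (take k π) ⊆ below h' (take k' π)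
  below-take-⊆ h≤h' k≤k' = filter⁺ _ _ (λ { refl x<h → <-≤-trans x<h h≤h' }) (take⁺ k≤k')

  below-drop-⊆ : ∀ {h h' k k'} → h ≤ h' → k' ≤ k → below h (drop k π) ⊆ below h' (drop k' π)
  below-drop-⊆ h≤h' k'≤k = filter⁺ _ _ (λ { refl x<h → <-≤-trans x<h h≤h' }) (drop⁺-≥ k'≤k)

module Covering (𝒜 ℬ 𝒞 𝒟 : PermClass) {π : List ℕ} (π-perm : IsPerm π) where
  open Quadrants π-perm

  grid-by-cover : ∀ {k h a b c d} → k ≤ length π → h ≤ length π →
    FormsIn 𝒜 a → above h (take k π) ⊆ a → FormsIn ℬ b → above h (drop k π) ⊆ b →
    FormsIn 𝒞 c → below h (take k π) ⊆ c → FormsIn 𝒟 d → below h (drop k π) ⊆ d →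
    Grid 𝒜 ℬ 𝒞 𝒟 π
  grid-by-cover {k} {h} k≤n h≤n A A⊇ B B⊇ C C⊇ D D⊇ =
    π-perm , k , h , k≤n , h≤n ,
    FormsIn-⊆ 𝒜 A A⊇ (above-take-unique h k) , FormsIn-⊆ ℬ B B⊇ (above-drop-unique h k) ,
    FormsIn-⊆ 𝒞 C C⊇ (below-take-unique h k) , FormsIn-⊆ 𝒟 D D⊇ (below-drop-unique h k)

  -- If k ≤ k', the right side of k' lies in
  -- that of k and the left side of k in that of k'; the cut is at l' when
  -- l' ≤ r and at r when r ≤ l'.  The case k' ≤ k is symmetric.
  grid-from-triples : ∀ {k r l k' r' l'} →
    DivisionTriple 𝒜 ℬ 𝒞 𝒟 π k r l → l ≤ r →
    DivisionTriple 𝒜 ℬ 𝒞 𝒟 π k' r' l' → r' ≤ l' → Grid 𝒜 ℬ 𝒞 𝒟 π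
  grid-from-triples {k} {r} {l} {k'} {r'} {l'}
    (k≤n , r≤n , l≤n , A , C , B , D) l≤r (k'≤n , r'≤n , l'≤n , A' , C' , B' , D') r'≤l'
    with ≤-total k k' | ≤-total l' r | ≤-total r' l
  ... | inj₁ k≤k' | inj₁ l'≤r | _ =
    grid-by-cover k'≤n l'≤n A' ⊆-refl B' (above-drop-⊆ r'≤l' (≤-refl {k'}))
                            C' ⊆-refl D (below-drop-⊆ l'≤r k≤k')
  ... | inj₁ k≤k' | inj₂ r≤l' | _ =
    grid-by-cover k≤n r≤n A (above-take-⊆ l≤r (≤-refl {k})) B ⊆-refl
                          C' (below-take-⊆ r≤l' k≤k') D ⊆-refl
  ... | inj₂ k'≤k | _ | inj₁ r'≤l =
    grid-by-cover k≤n l≤n A ⊆-refl B' (above-drop-⊆ r'≤l k'≤k)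
                          C ⊆-refl D (below-drop-⊆ l≤r (≤-refl {k}))
  ... | inj₂ k'≤k | _ | inj₂ l≤r' =
    grid-by-cover k'≤n r'≤n A (above-take-⊆ l≤r' k'≤k) B' ⊆-refl
                            C' (below-take-⊆ r'≤l' (≤-refl {k'})) D' ⊆-refl

lemma5 : (𝒜 ℬ 𝒞 𝒟 : PermClass) (π : List ℕ) →
    Grid 𝒜 ℬ 𝒞 𝒟 π ⇔ (S≤ 𝒜 ℬ 𝒞 𝒟 π × S≥ 𝒜 ℬ 𝒞 𝒟 π)
lemma5 𝒜 ℬ 𝒞 𝒟 π = mk⇔ grid⇒S≤∩S≥ S≤∩S≥⇒grid
  where
  grid⇒S≤∩S≥ : Grid 𝒜 ℬ 𝒞 𝒟 π → S≤ 𝒜 ℬ 𝒞 𝒟 π × S≥ 𝒜 ℬ 𝒞 𝒟 π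
  grid⇒S≤∩S≥ (π-perm , k , h , k≤n , h≤n , A , B , C , D) =
    (π-perm , k , h , h , triple , ≤-refl) , (π-perm , k , h , h , triple , ≤-refl)
    where
    triple : DivisionTriple 𝒜 ℬ 𝒞 𝒟 π k h h
    triple = k≤n , h≤n , h≤n , A , C , B , D

  S≤∩S≥⇒grid : S≤ 𝒜 ℬ 𝒞 𝒟 π × S≥ 𝒜 ℬ 𝒞 𝒟 π → Grid 𝒜 ℬ 𝒞 𝒟 π
  S≤∩S≥⇒grid ((π-perm , _ , _ , _ , triple≤ , l≤r) , (_ , _ , _ , _ , triple≥ , r'≤l')) =
    Covering.grid-from-triples 𝒜 ℬ 𝒞 𝒟 π-perm triple≤ l≤r triple≥ r'≤l'
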